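{- Let $G$ be a graph, $U\subseteq V(G)$ and $\ell\in\mathbb{N}$. If the algorithm ApproxPHCAD returns a set $A$ of size at most $6\ell$ when called on $G'=\mathsf{copy}(G,U,6\ell)$, then for every obstruction $\mathbb{O}$ of $G$, $|V(\mathbb{O})\cap U|+1\le |V(\mathbb{O})\cap(U\cup(A\cap V(G)))|$.
   Context: A proper Helly circular-arc graph is the intersection graph of a finite family of arcs on a circle such that no arc properly contains another and every subfamily of pairwise intersecting arcs has a common point. ApproxPHCAD is a polynomial-time 6-approximation algorithm for PHCAVD: given $H$ it returns $S\subseteq V(H)$ with $H-S$ a proper Helly circular-arc graph and $|S|$ at most 6 times the minimum size of such a set. An obstruction of $G$ is an induced subgraph isomorphic to one of: the claw $K_{1,3}$; the net (triangle with a pendant at each triangle vertex); the tent (triangle $a,b,c$ plus $x,y,z$ with $x$ adjacent exactly to $a,b$, $y$ to $b,c$, $z$ to $a,c$); $W_4$, $W_5$ (induced $C_4$, resp. $C_5$, plus a universal vertex); $\overline{C_6}$; or $C_\ell^*$, $\ell\ge4$ (induced $C_\ell$ plus an isolated vertex); a graph is proper Helly circular-arc iff it has no obstruction. $\mathsf{copy}(G,U,t)$ is obtained from $G$ by adding, for each $u\in U$, $t$ new vertices $u^1,\dots,u^t$ such that $u,u^1,\dots,u^t$ form a clique, each $u^i$ is adjacent to every neighbor of $u$ in $G$, and $u^iv^j$ is an edge whenever $uv\in E(G)$ with $u,v\in U$. -}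

module Defs where

open import Data.Nat using (ℕ; zero; suc; _+_; _*_; _≡ᵇ_; _<ᵇ_)
open import Data.Bool using (Bool; true; false; T; _∧_; _∨_; not)
open import Data.Fin using (Fin; toℕ)
open import Data.Fin.Properties using () renaming (_≟_ to _≟F_)
open import Data.Fin.Subset using (Subset; _∈_)
open import Data.Fin.Subset.Properties using (_∈?_)
open import Data.Vec using (Vec; _[_]=_; here; there)
open import Data.List using (List; []; _∷_; length; filter; allFin)
open import Data.List.Membership.Propositional using () renaming (_∈_ to _∈L_; _∉_ to _∉L_)
import Data.List.Membership.DecPropositional as DecMem
open import Data.Product using (Σ; _×_; _,_; proj₁; proj₂)
open import Data.Product.Properties using () renaming (≡-dec to Σ-≡-dec)
open import Data.Sum using (_⊎_; inj₁; inj₂)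
open import Data.Sum.Properties using () renaming (≡-dec to ⊎-≡-dec)
open import Relation.Nullary using (¬_; Dec; yes; no)
open import Relation.Nullary.Decidable using (_⊎-dec_)
open import Relation.Unary using (Decidable)
open import Relation.Binary.Definitions using (DecidableEquality)
open import Relation.Binary.PropositionalEquality using (_≡_; _≢_; refl; sym; cong)
open import Axiom.UniquenessOfIdentityProofs using (module Decidable⇒UIP)
import Data.Bool.Properties as BoolP

record Graph (V : Set) : Set₁ where
  field
    _~_      : V → V → Set
    ~-sym    : ∀ {u v} → u ~ v → v ~ u
    ~-irrefl : ∀ {v} → ¬ (v ~ v)
open Graph public

_─_ : ∀ {V} → Graph V → (S : List V) → Graph (Σ V (λ v → v ∉L S))
_─_ {V} H S = record
  { _~_      = λ a b → H ._~_ (proj₁ a) (proj₁ b)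
  ; ~-sym    = H .~-sym
  ; ~-irrefl = H .~-irrefl
  }

data ObsType : Set where
  claw net tent W4 W5 C6bar : ObsType
  -- Cstar m is C_ℓ^* with ℓ = m + 4 (so ℓ ≥ 4 ranges over all lengths)
  Cstar : ℕ → ObsType

size : ObsType → ℕ
size claw      = 4
size net       = 6
size tent      = 6
size W4        = 5
size W5        = 6
size C6bar     = 6
size (Cstar m) = suc (m + 4)

edgeIn : List (ℕ × ℕ) → ℕ → ℕ → Bool
edgeIn []             a b = false
edgeIn ((x , y) ∷ es) a b =
  ((x ≡ᵇ a) ∧ (y ≡ᵇ b)) ∨ ((x ≡ᵇ b) ∧ (y ≡ᵇ a)) ∨ edgeIn es a b

clawEdges : List (ℕ × ℕ)
clawEdges = (0 , 1) ∷ (0 , 2) ∷ (0 , 3) ∷ []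

netEdges : List (ℕ × ℕ)
netEdges = (0 , 1) ∷ (1 , 2) ∷ (0 , 2) ∷ (0 , 3) ∷ (1 , 4) ∷ (2 , 5) ∷ []

-- tent: triangle a=0 b=1 c=2, x=3 ~ a,b ; y=4 ~ b,c ; z=5 ~ a,c
tentEdges : List (ℕ × ℕ)
tentEdges = (0 , 1) ∷ (1 , 2) ∷ (0 , 2)
          ∷ (3 , 0) ∷ (3 , 1) ∷ (4 , 1) ∷ (4 , 2) ∷ (5 , 0) ∷ (5 , 2) ∷ []

W4Edges : List (ℕ × ℕ)
W4Edges = (0 , 1) ∷ (1 , 2) ∷ (2 , 3) ∷ (3 , 0)
        ∷ (4 , 0) ∷ (4 , 1) ∷ (4 , 2) ∷ (4 , 3) ∷ []

W5Edges : List (ℕ × ℕ)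
W5Edges = (0 , 1) ∷ (1 , 2) ∷ (2 , 3) ∷ (3 , 4) ∷ (4 , 0)
        ∷ (5 , 0) ∷ (5 , 1) ∷ (5 , 2) ∷ (5 , 3) ∷ (5 , 4) ∷ []

C6barEdges : List (ℕ × ℕ)
C6barEdges = (0 , 2) ∷ (0 , 3) ∷ (0 , 4) ∷ (1 , 3) ∷ (1 , 4) ∷ (1 , 5)
           ∷ (2 , 4) ∷ (2 , 5) ∷ (3 , 5) ∷ []

-- C_ℓ^*: cycle 0-1-...-(ℓ-1)-0 on vertices < ℓ, vertex ℓ isolated
cycStar : ℕ → ℕ → ℕ → Bool
cycStar ℓ a b = (a <ᵇ ℓ) ∧ (b <ᵇ ℓ) ∧
  ((suc a ≡ᵇ b) ∨ (suc b ≡ᵇ a) ∨ ((a ≡ᵇ 0) ∧ (suc b ≡ᵇ ℓ)) ∨ ((b ≡ᵇ 0) ∧ (suc a ≡ᵇ ℓ)))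

obsAdj : (o : ObsType) → Fin (size o) → Fin (size o) → Bool
obsAdj claw      i j = edgeIn clawEdges  (toℕ i) (toℕ j)
obsAdj net       i j = edgeIn netEdges   (toℕ i) (toℕ j)
obsAdj tent      i j = edgeIn tentEdges  (toℕ i) (toℕ j)
obsAdj W4        i j = edgeIn W4Edges    (toℕ i) (toℕ j)
obsAdj W5        i j = edgeIn W5Edges    (toℕ i) (toℕ j)
obsAdj C6bar     i j = edgeIn C6barEdges (toℕ i) (toℕ j)
obsAdj (Cstar m) i j = cycStar (m + 4) (toℕ i) (toℕ j)

record Obstruction {V : Set} (H : Graph V) : Set where
  field
    type    : ObsType
    emb     : Fin (size type) → V
    emb-inj : ∀ i j → emb i ≡ emb j → i ≡ j
    emb-adj : ∀ i j → H ._~_ (emb i) (emb j) → T (obsAdj type i j)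
    emb-adj⁻ : ∀ i j → T (obsAdj type i j) → H ._~_ (emb i) (emb j)
open Obstruction public

-- Proper Helly circular-arc graph, via the characterisation given in the
-- paper's context: a graph is PHCA iff it has no obstruction.
PHCA : ∀ {V} → Graph V → Set
PHCA H = ¬ Obstruction H

∣_∩_∣ : ∀ {V} {H : Graph V} (O : Obstruction H) {P : V → Set} → Decidable P → ℕ
∣ O ∩ P? ∣ = length (filter (λ i → P? (emb O i)) (allFin (size (type O))))

Copies : (n : ℕ) → Subset n → ℕ → Set
Copies n U t = Σ (Fin n) (λ u → u ∈ U) × Fin t

-- V(copy(G,U,t)) = V(G) ⊎ new vertices; inj₁ v is the original v
CopyV : (n : ℕ) → Subset n → ℕ → Set
CopyV n U t = Fin n ⊎ Copies n U t

base : ∀ {n U t} → CopyV n U t → Fin n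
base (inj₁ v)           = v
base (inj₂ ((u , _) , _)) = u

-- a ~ b in copy(G,U,t) iff they are distinct copies of the same vertex
-- (u, u^1, ..., u^t form a clique) or their originals are adjacent in G
copy : ∀ {n} → Graph (Fin n) → (U : Subset n) → (t : ℕ) → Graph (CopyV n U t)
copy G U t = record
  { _~_      = λ a b → (base a ≡ base b × a ≢ b) ⊎ G ._~_ (base a) (base b)
  ; ~-sym    = λ { (inj₁ (e , d)) → inj₁ (sym e , λ x → d (sym x))
                 ; (inj₂ e)       → inj₂ (G .~-sym e) }
  ; ~-irrefl = λ { (inj₁ (_ , d)) → d refl
                 ; (inj₂ e)       → G .~-irrefl e }
  }

-- decidable equality on V(copy(G,U,t)), needed to decide A ∩ V(G)

[]=-irrelevant : ∀ {k} {xs : Vec Bool k} {i : Fin k} {b : Bool} (p q : xs [ i ]= b) → p ≡ q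
[]=-irrelevant here      here      = refl
[]=-irrelevant (there p) (there q) = cong there ([]=-irrelevant p q)

∈-irrelevant : ∀ {n} {U : Subset n} {u : Fin n} (p q : u ∈ U) → p ≡ q
∈-irrelevant = []=-irrelevant

_≟V_ : ∀ {n U t} → DecidableEquality (CopyV n U t)
_≟V_ {n} {U} {t} = ⊎-≡-dec _≟F_
  (Σ-≡-dec (Σ-≡-dec _≟F_ (λ p q → yes (∈-irrelevant p q))) _≟F_)

_∩VG : ∀ {n U t} → List (CopyV n U t) → Fin n → Set
(A ∩VG) v = inj₁ v ∈L A

U∪[A∩VG]? : ∀ {n U t} (A : List (CopyV n U t)) → Decidable (λ v → v ∈ U ⊎ (A ∩VG) v)
U∪[A∩VG]? {U = U} A v = (v ∈? U) ⊎-dec (inj₁ v ∈L? A)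
  where open DecMem _≟V_ using () renaming (_∈?_ to _∈L?_)

{-# OPTIONS --safe #-}
-- If every vertex of the obstruction O outside U were missed by A, then O
-- would survive in copy(G, U, t) − A: a vertex outside U is itself not in A,
-- and a vertex u ∈ U has t + 1 > |A| copies u, u¹, …, uᵗ, one of which escapes
-- A. Distinct vertices of O get copies of distinct vertices of G, which are
-- adjacent exactly when their originals are, so the chosen copies induce the
-- same obstruction — contradicting that copy(G, U, t) − A is PHCA. Hence A
-- contains a vertex of O outside U, which makes the second count exceed the
-- first.
module Submission where

open import Defs
open import Data.Nat using (ℕ; suc; _+_; _*_; _≤_; _<_; z≤n; s≤s)
open import Data.Nat.Properties using (+-comm; m≤n⇒m≤1+n)
open import Data.Fin using (Fin; zero; suc)
open import Data.Fin.Properties using (pigeonhole; <⇒≢; ¬∀⟶∃¬; any?)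
open import Data.Fin.Subset using (Subset; _∈_; _∉_)
open import Data.Fin.Subset.Properties using (_∈?_)
open import Data.List using (List; []; _∷_; length; filter; allFin; lookup)
open import Data.List.Relation.Unary.Any using (Any; here; there; index)
open import Data.List.Relation.Unary.Any.Properties using (lookup-index)
open import Data.List.Relation.Unary.Unique.Propositional using (Unique)
open import Data.List.Membership.Propositional using (lose) renaming (_∈_ to _∈L_; _∉_ to _∉L_)
open import Data.List.Membership.Propositional.Properties using (∈-allFin)
import Data.List.Membership.DecPropositional as DecMembership
open import Data.Product using (∃; _×_; _,_; proj₁; proj₂)
open import Data.Sum using (inj₁; inj₂)
open import Data.Bool using (T)
open import Data.Empty using (⊥-elim)
open import Function using (_∘_)
open import Function.Definitions using (Injective)
open import Relation.Nullary using (¬_; yes; no; ¬?)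
open import Relation.Nullary.Decidable using (_×-dec_)
open import Relation.Unary using (Decidable)
open import Relation.Binary.Definitions using (DecidableEquality)
open import Relation.Binary.PropositionalEquality using (_≡_; refl; sym; trans; cong; subst; subst₂; module ≡-Reasoning)

module _ {X : Set} {P Q : X → Set} (P? : Decidable P) (Q? : Decidable Q)
         (P⊆Q : ∀ {x} → P x → Q x) where

  length-filter-mono : ∀ xs → length (filter P? xs) ≤ length (filter Q? xs)
  length-filter-mono [] = z≤n
  length-filter-mono (x ∷ xs) with P? x | Q? x
  ... | yes _  | yes _  = s≤s (length-filter-mono xs)
  ... | yes px | no ¬qx = ⊥-elim (¬qx (P⊆Q px))
  ... | no _   | yes _  = m≤n⇒m≤1+n (length-filter-mono xs)
  ... | no _   | no _   = length-filter-mono xs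

  length-filter-strictMono : ∀ xs → Any (λ x → ¬ P x × Q x) xs →
                             length (filter P? xs) < length (filter Q? xs)
  length-filter-strictMono (x ∷ xs) (here (¬px , qx)) with P? x | Q? x
  ... | yes px | _      = ⊥-elim (¬px px)
  ... | no _   | yes _  = s≤s (length-filter-mono xs)
  ... | no _   | no ¬qx = ⊥-elim (¬qx qx)
  length-filter-strictMono (x ∷ xs) (there any) with P? x | Q? x
  ... | yes _  | yes _  = s≤s (length-filter-strictMono xs any)
  ... | yes px | no ¬qx = ⊥-elim (¬qx (P⊆Q px))
  ... | no _   | yes _  = m≤n⇒m≤1+n (length-filter-strictMono xs any)
  ... | no _   | no _   = length-filter-strictMono xs any

module _ {X : Set} (_≟_ : DecidableEquality X) where
  open DecMembership _≟_ using () renaming (_∈?_ to _∈L?_)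

  injection-escapes : ∀ {m} (f : Fin m → X) → Injective _≡_ _≡_ f →
                      (xs : List X) → length xs < m → ∃ λ k → f k ∉L xs
  injection-escapes {m} f f-inj xs xs<m =
    ¬∀⟶∃¬ m (λ k → f k ∈L xs) (λ k → f k ∈L? xs) all∈⇒⊥
    where
    all∈⇒⊥ : ¬ (∀ k → f k ∈L xs)
    all∈⇒⊥ f∈xs with i , j , i<j , same-index ← pigeonhole xs<m (index ∘ f∈xs) =
      <⇒≢ i<j (f-inj (begin
        f i                           ≡⟨ lookup-index (f∈xs i) ⟩
        lookup xs (index (f∈xs i))    ≡⟨ cong (lookup xs) same-index ⟩
        lookup xs (index (f∈xs j))    ≡⟨ lookup-index (f∈xs j) ⟨
        f j                           ∎))
      where open ≡-Reasoning

obstruction-─ : ∀ {V} {H : Graph V} {S : List V} (O : Obstruction H) →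
                (∀ i → emb O i ∉L S) → Obstruction (H ─ S)
obstruction-─ O avoids = record
  { type     = type O
  ; emb      = λ i → emb O i , avoids i
  ; emb-inj  = λ i j → emb-inj O i j ∘ cong proj₁
  ; emb-adj  = emb-adj O
  ; emb-adj⁻ = emb-adj⁻ O
  }

module _ {n} {U : Subset n} {t : ℕ} where

  copies : ∀ {u} → u ∈ U → Fin (suc t) → CopyV n U t
  copies {u} _   zero    = inj₁ u
  copies {u} u∈U (suc k) = inj₂ ((u , u∈U) , k)

  base-copies : ∀ {u} (u∈U : u ∈ U) k → base (copies u∈U k) ≡ u
  base-copies _ zero    = refl
  base-copies _ (suc k) = refl

  copies-injective : ∀ {u} (u∈U : u ∈ U) → Injective _≡_ _≡_ (copies u∈U)
  copies-injective _ {zero}  {zero}  _    = refl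
  copies-injective _ {suc _} {suc _} refl = refl

  copy-escapes : (A : List (CopyV n U t)) → length A ≤ t →
                 ∀ {u} → u ∈ U → ∃ λ v → base v ≡ u × v ∉L A
  copy-escapes A A≤t u∈U
    with k , k∉A ← injection-escapes _≟V_ (copies u∈U) (copies-injective u∈U) A (s≤s A≤t) =
    copies u∈U k , base-copies u∈U k , k∉A

  obstruction-copy : {G : Graph (Fin n)} (O : Obstruction G)
                     (s : Fin (size (type O)) → CopyV n U t) →
                     (∀ i → base (s i) ≡ emb O i) → Obstruction (copy G U t)
  obstruction-copy {G} O s base-s = record
    { type     = type O
    ; emb      = s
    ; emb-inj  = λ i j → emb-inj O i j ∘ same-base ∘ cong base
    ; emb-adj  = adj
    ; emb-adj⁻ = λ i j o → inj₂ (subst₂ (G ._~_) (sym (base-s i)) (sym (base-s j)) (emb-adj⁻ O i j o))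
    }
    where
    same-base : ∀ {i j} → base (s i) ≡ base (s j) → emb O i ≡ emb O j
    same-base {i} {j} e = trans (sym (base-s i)) (trans e (base-s j))

    adj : ∀ i j → copy G U t ._~_ (s i) (s j) → T (obsAdj (type O) i j)
    adj i j (inj₁ (e , si≢sj)) = ⊥-elim (si≢sj (cong s (emb-inj O i j (same-base e))))
    adj i j (inj₂ g)           = emb-adj O i j (subst₂ (G ._~_) (base-s i) (base-s j) g)

  obstruction-hit-outside : {G : Graph (Fin n)} (A : List (CopyV n U t)) → length A ≤ t →
                            PHCA (copy G U t ─ A) → (O : Obstruction G) →
                            ∃ λ i → emb O i ∉ U × inj₁ (emb O i) ∈L A
  obstruction-hit-outside A A≤t A-phca O
    with any? (λ i → ¬? (emb O i ∈? U) ×-dec (inj₁ (emb O i) ∈L? A))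
    where open DecMembership _≟V_ using () renaming (_∈?_ to _∈L?_)
  ... | yes hit = hit
  ... | no ¬hit =
    ⊥-elim (A-phca (obstruction-─ (obstruction-copy O (proj₁ ∘ escape) (proj₁ ∘ proj₂ ∘ escape))
                                  (proj₂ ∘ proj₂ ∘ escape)))
    where
    escape : ∀ i → ∃ λ v → base v ≡ emb O i × v ∉L A
    escape i with emb O i ∈? U
    ... | yes u∈U = copy-escapes A A≤t u∈U
    ... | no u∉U  = inj₁ (emb O i) , refl , λ u∈A → ¬hit (i , u∉U , u∈A)

lemma5 : ∀ {n} (G : Graph (Fin n)) (U : Subset n) (ℓ : ℕ)
    (A : List (CopyV n U (6 * ℓ))) →
    Unique A →
    PHCA (copy G U (6 * ℓ) ─ A) →
    (∀ (S : List (CopyV n U (6 * ℓ))) → Unique S →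
    PHCA (copy G U (6 * ℓ) ─ S) → length A ≤ 6 * length S) →
    length A ≤ 6 * ℓ →
    (O : Obstruction G) →
    ∣ O ∩ (_∈? U) ∣ + 1 ≤ ∣ O ∩ U∪[A∩VG]? A ∣
lemma5 G U ℓ A _ A-phca _ A≤6ℓ O
  with i , i∉U , i∈A ← obstruction-hit-outside A A≤6ℓ A-phca O =
  subst (_≤ ∣ O ∩ U∪[A∩VG]? A ∣) (+-comm 1 ∣ O ∩ (_∈? U) ∣)
    (length-filter-strictMono (λ i → emb O i ∈? U) (λ i → U∪[A∩VG]? A (emb O i)) inj₁
      (allFin _) (lose (∈-allFin i) (i∉U , inj₂ i∈A)))
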